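{- For all integers $1\le k\le n$, $\hat{E}_{k,n}(-1)=\pm\binom{n-1}{k-1}$, i.e. $\hat{E}_{k,n}(-1)$ equals either $\binom{n-1}{k-1}$ or $-\binom{n-1}{k-1}$.
   Context: Place $1,\dots,n$ clockwise on a circle. Distinct elements $a_1,\dots,a_r\in[n]$ are in clockwise cyclic order if some cyclic rotation of $(a_1,\dots,a_r)$ is strictly increasing. For $\pi\in S_n$, position $i$ is a weak excedence if $\pi(i)\ge i$. An unordered pair $\{i,j\}$ of distinct elements is an alignment of $\pi$ if for one of the two orderings $(i,j)$ either (a) $\pi(i)\ne i$, $\pi(j)\ne j$, and $i,\pi(i),\pi(j),j$ are four distinct elements in clockwise cyclic order, or (b) $\pi(i)=i$, $\pi(j)\ne j$, and $i,\pi(j),j$ are in clockwise cyclic order. $E_{k,n}(q)=\sum_\pi q^{k(n-k)-\mathrm{al}(\pi)}$ over $\pi\in S_n$ with exactly $k$ weak excedences, $\mathrm{al}(\pi)$ the number of alignments, and $\hat{E}_{k,n}(q)=q^{k-n}E_{k,n}(q)$. -}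

module Defs where

open import Data.Bool using (Bool; true; false; _∧_; _∨_; not; if_then_else_)
open import Data.Nat using (ℕ; zero; suc; _+_; _*_; _∸_; _≤ᵇ_; _<ᵇ_; _≡ᵇ_)
open import Data.Nat.Combinatorics using (_C_)
open import Data.Integer as ℤ using (ℤ; +_; -_)
open import Data.List using (List; []; _∷_; map; concatMap; length; filter; upTo; foldr; _++_)
open import Data.Bool.ListAction using (any; all)
open import Data.Product using (_×_; _,_; proj₁; proj₂)
open import Data.Bool using (T)
open import Relation.Nullary.Decidable using (T?)

-- Permutations of [n] = {1,…,n}, represented by their one-line notation
-- (π(1), …, π(n)) as a list of naturals.

insertions : ℕ → List ℕ → List (List ℕ)
insertions x []       = (x ∷ []) ∷ []
insertions x (y ∷ ys) = (x ∷ y ∷ ys) ∷ map (y ∷_) (insertions x ys)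

perms : List ℕ → List (List ℕ)
perms []       = [] ∷ []
perms (x ∷ xs) = concatMap (insertions x) (perms xs)

range : ℕ → List ℕ
range n = map suc (upTo n)

Sym : ℕ → List (List ℕ)
Sym n = perms (range n)

-- π(i) for i ∈ [n] (1-indexed lookup; default 0 never used for i ∈ [n])
nth : List ℕ → ℕ → ℕ
nth []       _       = 0
nth (x ∷ xs) zero    = x
nth (x ∷ xs) (suc i) = nth xs i

app : List ℕ → ℕ → ℕ
app π i = nth π (i ∸ 1)

weakExc : ℕ → List ℕ → ℕ
weakExc n π = length (filter (λ i → T? (i ≤ᵇ app π i)) (range n))

-- Clockwise cyclic order on 1,…,n placed clockwise on a circle

strictlyIncreasing : List ℕ → Bool
strictlyIncreasing []           = true
strictlyIncreasing (x ∷ [])     = true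
strictlyIncreasing (x ∷ y ∷ ys) = (x <ᵇ y) ∧ strictlyIncreasing (y ∷ ys)

notElem : ℕ → List ℕ → Bool
notElem x ys = all (λ y → not (x ≡ᵇ y)) ys

distinct : List ℕ → Bool
distinct []       = true
distinct (x ∷ xs) = notElem x xs ∧ distinct xs

rotate : List ℕ → List ℕ
rotate []       = []
rotate (x ∷ xs) = xs ++ (x ∷ [])

rotationsAux : ℕ → List ℕ → List (List ℕ)
rotationsAux zero    xs = []
rotationsAux (suc m) xs = xs ∷ rotationsAux m (rotate xs)

rotations : List ℕ → List (List ℕ)
rotations xs = rotationsAux (length xs) xs

cyclicOrder : List ℕ → Bool
cyclicOrder xs = distinct xs ∧ any strictlyIncreasing (rotations xs)

alignedOrd : List ℕ → ℕ → ℕ → Bool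
alignedOrd π i j =
  (not (app π i ≡ᵇ i) ∧ not (app π j ≡ᵇ j)
     ∧ cyclicOrder (i ∷ app π i ∷ app π j ∷ j ∷ []))
  ∨ ((app π i ≡ᵇ i) ∧ not (app π j ≡ᵇ j)
     ∧ cyclicOrder (i ∷ app π j ∷ j ∷ []))

isAlignment : List ℕ → ℕ → ℕ → Bool
isAlignment π i j = alignedOrd π i j ∨ alignedOrd π j i

pairs : ℕ → List (ℕ × ℕ)
pairs n = concatMap (λ i → map (λ j → (i , j)) (filter (λ j → T? (i <ᵇ j)) (range n))) (range n)

al : ℕ → List ℕ → ℕ
al n π = length (filter (λ p → T? (isAlignment π (proj₁ p) (proj₂ p))) (pairs n))

-- Evaluation at q = -1 of Laurent monomials q^e, e ∈ ℤ

even? : ℕ → Bool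
even? zero          = true
even? (suc zero)    = false
even? (suc (suc m)) = even? m

negOnePow : ℤ → ℤ
negOnePow e = if even? ℤ.∣ e ∣ then + 1 else - (+ 1)

sumℤ : List ℤ → ℤ
sumℤ = foldr ℤ._+_ (+ 0)

SymK : ℕ → ℕ → List (List ℕ)
SymK k n = filter (λ π → T? (weakExc n π ≡ᵇ k)) (Sym n)

expE : ℕ → ℕ → List ℕ → ℤ
expE k n π = (+ (k * (n ∸ k))) ℤ.- (+ al n π)

E-at-neg1 : ℕ → ℕ → ℤ
E-at-neg1 k n = sumℤ (map (λ π → negOnePow (expE k n π)) (SymK k n))

Ehat-at-neg1 : ℕ → ℕ → ℤ
Ehat-at-neg1 k n = negOnePow ((+ k) ℤ.- (+ n)) ℤ.* E-at-neg1 k n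

-- For i < j and π(i) ≠ π(j), whether {i, j} is an alignment of π depends only on the relative
-- order of i, π(i), j, π(j); replacing them by their ranks, an exhaustive check over values
-- below 5 shows that {i, j} is an alignment iff [π(j) < π(i)] + [i ≤ π(i)] + [j ≤ π(j)] is odd.
-- Summing over all pairs, al(π) ≡ inv(π) + (n - 1)·wex(π) (mod 2), so up to a sign depending
-- only on k and n, E_{k,n}(-1) is the coefficient of t^k in Σ_π sgn(π) t^wex(π).  That
-- polynomial is the determinant of the n × n matrix (t^[i ≤ j]).  Expanding along the column of
-- the least value (the recursion by which perms inserts it), all but two minors have two rows
-- equal to (t … t), and the remaining two give t (t - 1)^(n-1), whose coefficient of t^k is
-- ±C(n-1, k-1).
module Submission where

open import Defs
open import Data.Bool as Bool using (Bool; true; false; _∧_; _∨_; not; _xor_; if_then_else_; T)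
open import Data.Integer as ℤ using (ℤ; +_; -_; _-_)
import Data.Integer.Properties as ℤ
open import Data.List using (List; []; _∷_; _++_; map; filter; length; concatMap; applyUpTo; upTo)
import Data.List.Properties as List
open import Data.List.Membership.Propositional using (_∈_)
open import Data.List.Relation.Binary.Permutation.Propositional as ↭
  using (_↭_; ↭-refl; ↭-sym; ↭-trans; ↭-prep; ↭-swap; ↭⇒↭ₛ)
open import Data.List.Relation.Binary.Permutation.Propositional.Properties using (All-resp-↭; ↭-length)
open import Data.List.Relation.Unary.All as All using (All; []; _∷_)
import Data.List.Relation.Unary.All.Properties as All
open import Data.List.Relation.Unary.AllPairs as AllPairs using (AllPairs; []; _∷_)
import Data.List.Relation.Unary.AllPairs.Properties as AllPairs
open import Data.List.Relation.Unary.Any using (here; there)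
open import Data.Nat as ℕ using (ℕ; zero; suc; _+_; _*_; _∸_; _≤_; _<_; z≤n; s≤s; _<ᵇ_; _≤ᵇ_; _≡ᵇ_)
import Data.Nat.Properties as ℕ
open import Data.Nat.Combinatorics using (_C_; nCk+nC[k+1]≡[n+1]C[k+1]; k>n⇒nCk≡0)
open import Algebra.Properties.CommutativeSemigroup ℕ.+-commutativeSemigroup
  using (x∙yz≈y∙xz) renaming (interchange to +-interchange)
open import Algebra.Properties.CommutativeSemigroup ℤ.+-commutativeSemigroup
  using () renaming (interchange to ℤ-+-interchange)
open import Data.Product using (_×_; _,_; proj₁; proj₂)
open import Data.Sum as Sum using (_⊎_; inj₁; inj₂)
open import Function using (_∘_)
open import Relation.Binary using (tri<; tri≈; tri>)
open import Relation.Binary.PropositionalEquality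
open import Data.List.Relation.Binary.Permutation.Setoid.Properties (setoid ℕ) using (Unique-resp-↭)
open import Relation.Nullary.Decidable using (T?; dec-true; dec-false; from-yes; _→-dec_; ¬?)

bit : Bool → ℕ
bit true  = 1
bit false = 0

<ᵇ-true : ∀ {m n} → m < n → (m <ᵇ n) ≡ true
<ᵇ-true {m} {n} = dec-true (m ℕ.<? n)

<ᵇ-false : ∀ {m n} → n ≤ m → (m <ᵇ n) ≡ false
<ᵇ-false {m} {n} n≤m = dec-false (m ℕ.<? n) (ℕ.≤⇒≯ n≤m)

≤ᵇ-true : ∀ {m n} → m ≤ n → (m ≤ᵇ n) ≡ true
≤ᵇ-true {m} {n} = dec-true (m ℕ.≤? n)

≤ᵇ-false : ∀ {m n} → n < m → (m ≤ᵇ n) ≡ false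
≤ᵇ-false {m} {n} n<m = dec-false (m ℕ.≤? n) (ℕ.<⇒≱ n<m)

≡ᵇ-true : ∀ {m n} → m ≡ n → (m ≡ᵇ n) ≡ true
≡ᵇ-true {m} {n} = dec-true (m ℕ.≟ n)

≡ᵇ-false : ∀ {m n} → m ≢ n → (m ≡ᵇ n) ≡ false
≡ᵇ-false {m} {n} = dec-false (m ℕ.≟ n)

count : {A : Set} → (A → Bool) → List A → ℕ
count f []       = 0
count f (x ∷ xs) = bit (f x) + count f xs

module _ {A : Set} where

  length-filter≡count : ∀ (f : A → Bool) xs → length (filter (λ x → T? (f x)) xs) ≡ count f xs
  length-filter≡count f []       = refl
  length-filter≡count f (x ∷ xs) with f x
  ... | true  = cong suc (length-filter≡count f xs)
  ... | false = length-filter≡count f xs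

  count-++ : ∀ (f : A → Bool) xs ys → count f (xs ++ ys) ≡ count f xs + count f ys
  count-++ f []       ys = refl
  count-++ f (x ∷ xs) ys =
    trans (cong (_+_ (bit (f x))) (count-++ f xs ys)) (sym (ℕ.+-assoc (bit (f x)) _ _))

  count-map : ∀ {B : Set} f (g : B → A) xs → count f (map g xs) ≡ count (f ∘ g) xs
  count-map f g []       = refl
  count-map f g (x ∷ xs) = cong (_+_ (bit (f (g x)))) (count-map f g xs)

  count-const : ∀ b (xs : List A) → count (λ _ → b) xs ≡ length xs * bit b
  count-const b []       = refl
  count-const b (x ∷ xs) = cong (_+_ (bit b)) (count-const b xs)

  count-cong-local : ∀ {f g : A → Bool} {xs} → All (λ x → f x ≡ g x) xs → count f xs ≡ count g xs
  count-cong-local []       = refl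
  count-cong-local (e ∷ es) = cong₂ _+_ (cong bit e) (count-cong-local es)

  count≤length : ∀ (f : A → Bool) xs → count f xs ≤ length xs
  count≤length f []       = z≤n
  count≤length f (x ∷ xs) = ℕ.+-mono-≤ (bit≤1 (f x)) (count≤length f xs)
    where
    bit≤1 : ∀ b → bit b ≤ 1
    bit≤1 true  = s≤s z≤n
    bit≤1 false = z≤n

  count-resp-↭ : ∀ (f : A → Bool) {xs ys} → xs ↭ ys → count f xs ≡ count f ys
  count-resp-↭ f ↭.refl         = refl
  count-resp-↭ f (↭.prep x p)   = cong (_+_ (bit (f x))) (count-resp-↭ f p)
  count-resp-↭ f (↭.swap x y p) = trans (x∙yz≈y∙xz (bit (f x)) (bit (f y)) _)
    (cong (λ n → bit (f y) + (bit (f x) + n)) (count-resp-↭ f p))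
  count-resp-↭ f (↭.trans p q)  = trans (count-resp-↭ f p) (count-resp-↭ f q)

orderedPairs : {A : Set} → List A → List (A × A)
orderedPairs []       = []
orderedPairs (x ∷ xs) = map (x ,_) xs ++ orderedPairs xs

module _ {A : Set} where

  AllPairs⇒All-orderedPairs : ∀ {R : A → A → Set} {xs} →
    AllPairs R xs → All (λ (x , y) → R x y) (orderedPairs xs)
  AllPairs⇒All-orderedPairs []         = []
  AllPairs⇒All-orderedPairs (px ∷ pxs) = All.++⁺ (All.map⁺ px) (AllPairs⇒All-orderedPairs pxs)

  count-orderedPairs-endpoints : ∀ (h : A → Bool) xs →
    count (h ∘ proj₁) (orderedPairs xs) + count (h ∘ proj₂) (orderedPairs xs)
      ≡ (length xs ∸ 1) * count h xs
  count-orderedPairs-endpoints h []               = refl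
  count-orderedPairs-endpoints h (x ∷ [])         = refl
  count-orderedPairs-endpoints h (x ∷ xs@(_ ∷ _)) = begin
    count (h ∘ proj₁) (map (x ,_) xs ++ ps) + count (h ∘ proj₂) (map (x ,_) xs ++ ps)
      ≡⟨ cong₂ _+_ (count-++ (h ∘ proj₁) (map (x ,_) xs) ps)
                   (count-++ (h ∘ proj₂) (map (x ,_) xs) ps) ⟩
    (count (h ∘ proj₁) (map (x ,_) xs) + c₁) + (count (h ∘ proj₂) (map (x ,_) xs) + c₂)
      ≡⟨ cong₂ (λ u v → (u + c₁) + (v + c₂))
           (trans (count-map (h ∘ proj₁) (x ,_) xs) (count-const (h x) xs))
           (count-map (h ∘ proj₂) (x ,_) xs) ⟩
    (ℓ * bit (h x) + c₁) + (count h xs + c₂)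
      ≡⟨ +-interchange (ℓ * bit (h x)) c₁ (count h xs) c₂ ⟩
    (ℓ * bit (h x) + count h xs) + (c₁ + c₂)
      ≡⟨ ℕ.+-assoc (ℓ * bit (h x)) (count h xs) (c₁ + c₂) ⟩
    ℓ * bit (h x) + (count h xs + (c₁ + c₂))
      ≡⟨ cong (λ u → ℓ * bit (h x) + (count h xs + u)) (count-orderedPairs-endpoints h xs) ⟩
    ℓ * bit (h x) + ℓ * count h xs
      ≡⟨ ℕ.*-distribˡ-+ ℓ (bit (h x)) (count h xs) ⟨
    ℓ * count h (x ∷ xs) ∎
    where
    open ≡-Reasoning
    ℓ  = length xs
    ps = orderedPairs xs
    c₁ = count (h ∘ proj₁) ps
    c₂ = count (h ∘ proj₂) ps

-- Alignment of a single pair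

rank : List ℕ → ℕ → ℕ
rank S x = count (_<ᵇ x) S

bit-<ᵇ-mono : ∀ z {x y} → x ≤ y → bit (z <ᵇ x) ≤ bit (z <ᵇ y)
bit-<ᵇ-mono z {x} {y} x≤y with z <ᵇ x in eq
... | false = z≤n
... | true  = ℕ.≤-reflexive (cong bit (sym (<ᵇ-true (ℕ.<-≤-trans z<x x≤y))))
  where
  z<x : z < x
  z<x = ℕ.<ᵇ⇒< z x (subst T (sym eq) _)

rank-mono : ∀ S {x y} → x ≤ y → rank S x ≤ rank S y
rank-mono []      x≤y = z≤n
rank-mono (z ∷ S) x≤y = ℕ.+-mono-≤ (bit-<ᵇ-mono z x≤y) (rank-mono S x≤y)

rank-strict : ∀ S {x y} → x ∈ S → x < y → rank S x < rank S y
rank-strict (z ∷ S) {x} {y} (here refl) x<y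
  rewrite <ᵇ-false {x} {x} ℕ.≤-refl | <ᵇ-true x<y = s≤s (rank-mono S (ℕ.<⇒≤ x<y))
rank-strict (z ∷ S) (there x∈S) x<y =
  ℕ.+-mono-≤-< (bit-<ᵇ-mono z (ℕ.<⇒≤ x<y)) (rank-strict S x∈S x<y)

StrictlyIncreasingOn : List ℕ → (ℕ → ℕ) → Set
StrictlyIncreasingOn S f = ∀ {x y} → x ∈ S → y ∈ S → x < y → f x < f y

module _ {S : List ℕ} {f : ℕ → ℕ} (mono : StrictlyIncreasingOn S f) where

  <ᵇ-preserved : ∀ {x y} → x ∈ S → y ∈ S → (x <ᵇ y) ≡ (f x <ᵇ f y)
  <ᵇ-preserved {x} {y} x∈S y∈S with ℕ.<-cmp x y
  ... | tri< x<y _ _  = trans (<ᵇ-true x<y) (sym (<ᵇ-true (mono x∈S y∈S x<y)))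
  ... | tri≈ _ refl _ = trans (<ᵇ-false {x} ℕ.≤-refl) (sym (<ᵇ-false {f x} ℕ.≤-refl))
  ... | tri> _ _ y<x  =
    trans (<ᵇ-false (ℕ.<⇒≤ y<x)) (sym (<ᵇ-false (ℕ.<⇒≤ (mono y∈S x∈S y<x))))

  ≤ᵇ-preserved : ∀ {x y} → x ∈ S → y ∈ S → (x ≤ᵇ y) ≡ (f x ≤ᵇ f y)
  ≤ᵇ-preserved {x} {y} x∈S y∈S with ℕ.<-cmp x y
  ... | tri< x<y _ _  =
    trans (≤ᵇ-true (ℕ.<⇒≤ x<y)) (sym (≤ᵇ-true (ℕ.<⇒≤ (mono x∈S y∈S x<y))))
  ... | tri≈ _ refl _ = trans (≤ᵇ-true {x} ℕ.≤-refl) (sym (≤ᵇ-true {f x} ℕ.≤-refl))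
  ... | tri> _ _ y<x  = trans (≤ᵇ-false y<x) (sym (≤ᵇ-false (mono y∈S x∈S y<x)))

  ≡ᵇ-preserved : ∀ {x y} → x ∈ S → y ∈ S → (x ≡ᵇ y) ≡ (f x ≡ᵇ f y)
  ≡ᵇ-preserved {x} {y} x∈S y∈S with ℕ.<-cmp x y
  ... | tri< x<y _ _  =
    trans (≡ᵇ-false (ℕ.<⇒≢ x<y)) (sym (≡ᵇ-false (ℕ.<⇒≢ (mono x∈S y∈S x<y))))
  ... | tri≈ _ refl _ = trans (≡ᵇ-true {x} refl) (sym (≡ᵇ-true {f x} refl))
  ... | tri> _ _ y<x  =
    trans (≡ᵇ-false (ℕ.>⇒≢ y<x)) (sym (≡ᵇ-false (ℕ.>⇒≢ (mono y∈S x∈S y<x))))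

alignBit : ℕ → ℕ → ℕ → ℕ → Bool
alignBit i a j b = ordered i a j b ∨ ordered j b i a
  where
  ordered : ℕ → ℕ → ℕ → ℕ → Bool
  ordered i a j b =
    (not (a ≡ᵇ i) ∧ not (b ≡ᵇ j) ∧ cyclicOrder (i ∷ a ∷ b ∷ j ∷ []))
    ∨ ((a ≡ᵇ i) ∧ not (b ≡ᵇ j) ∧ cyclicOrder (i ∷ b ∷ j ∷ []))

isAlignment≡alignBit : ∀ π i j → isAlignment π i j ≡ alignBit i (app π i) j (app π j)
isAlignment≡alignBit π i j = refl

alignParity : ℕ → ℕ → ℕ → ℕ → Bool
alignParity i a j b = ((b <ᵇ a) xor (i ≤ᵇ a)) xor (j ≤ᵇ b)

module _ {i a j b : ℕ} {f : ℕ → ℕ} (mono : StrictlyIncreasingOn (i ∷ a ∷ j ∷ b ∷ []) f) where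

  private
    S : List ℕ
    S = i ∷ a ∷ j ∷ b ∷ []
    i∈ : i ∈ S
    i∈ = here refl
    a∈ : a ∈ S
    a∈ = there (here refl)
    j∈ : j ∈ S
    j∈ = there (there (here refl))
    b∈ : b ∈ S
    b∈ = there (there (there (here refl)))
    lt : ∀ {x y} → x ∈ S → y ∈ S → (x <ᵇ y) ≡ (f x <ᵇ f y)
    lt = <ᵇ-preserved mono
    le : ∀ {x y} → x ∈ S → y ∈ S → (x ≤ᵇ y) ≡ (f x ≤ᵇ f y)
    le = ≤ᵇ-preserved mono
    eq : ∀ {x y} → x ∈ S → y ∈ S → (x ≡ᵇ y) ≡ (f x ≡ᵇ f y)
    eq = ≡ᵇ-preserved mono

  -- alignBit compares its arguments only by _<ᵇ_ and _≡ᵇ_ (a <ᵇ j and b <ᵇ i never occur).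
  alignBit-relabel : alignBit i a j b ≡ alignBit (f i) (f a) (f j) (f b)
  alignBit-relabel
    rewrite lt i∈ a∈ | lt i∈ j∈ | lt i∈ b∈ | lt a∈ i∈ | lt a∈ b∈ | lt j∈ i∈
          | lt j∈ a∈ | lt j∈ b∈ | lt b∈ a∈ | lt b∈ j∈
          | eq i∈ a∈ | eq i∈ j∈ | eq i∈ b∈ | eq a∈ i∈ | eq a∈ j∈ | eq a∈ b∈
          | eq j∈ i∈ | eq j∈ a∈ | eq j∈ b∈ | eq b∈ i∈ | eq b∈ a∈ | eq b∈ j∈ = refl

  alignParity-relabel : alignParity i a j b ≡ alignParity (f i) (f a) (f j) (f b)
  alignParity-relabel = cong₂ _xor_ (cong₂ _xor_ (lt b∈ a∈) (le i∈ a∈)) (le j∈ b∈)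

  relabel-preserves-≢ : a ≢ b → f a ≢ f b
  relabel-preserves-≢ a≢b fa≡fb =
    a≢b (ℕ.≡ᵇ⇒≡ a b (subst T (sym (eq a∈ b∈)) (ℕ.≡⇒≡ᵇ (f a) (f b) fa≡fb)))

alignBit-parity-<5 : ∀ {i} → i < 5 → ∀ {a} → a < 5 → ∀ {j} → j < 5 → ∀ {b} → b < 5 →
  i < j → a ≢ b → alignBit i a j b ≡ alignParity i a j b
alignBit-parity-<5 = from-yes
  (ℕ.allUpTo? (λ i → ℕ.allUpTo? (λ a → ℕ.allUpTo? (λ j → ℕ.allUpTo? (λ b →
    (i ℕ.<? j) →-dec (¬? (a ℕ.≟ b) →-dec (alignBit i a j b Bool.≟ alignParity i a j b)))
    5) 5) 5) 5)

alignBit-parity : ∀ {i a j b} → i < j → a ≢ b → alignBit i a j b ≡ alignParity i a j b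
alignBit-parity {i} {a} {j} {b} i<j a≢b = begin
  alignBit i a j b
    ≡⟨ alignBit-relabel mono ⟩
  alignBit (r i) (r a) (r j) (r b)
    ≡⟨ alignBit-parity-<5 (bound i) (bound a) (bound j) (bound b)
         (mono (here refl) (there (there (here refl))) i<j) (relabel-preserves-≢ mono a≢b) ⟩
  alignParity (r i) (r a) (r j) (r b)
    ≡⟨ alignParity-relabel mono ⟨
  alignParity i a j b ∎
  where
  open ≡-Reasoning
  S = i ∷ a ∷ j ∷ b ∷ []
  r = rank S
  mono : StrictlyIncreasingOn S r
  mono x∈S _ = rank-strict S x∈S
  bound : ∀ x → r x < 5
  bound x = s≤s (count≤length (_<ᵇ x) S)

∑ : {A : Set} → (A → ℤ) → List A → ℤ
∑ f xs = sumℤ (map f xs)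

module _ {A : Set} where

  ∑-++ : ∀ (f : A → ℤ) xs ys → ∑ f (xs ++ ys) ≡ ∑ f xs ℤ.+ ∑ f ys
  ∑-++ f []       ys = sym (ℤ.+-identityˡ (∑ f ys))
  ∑-++ f (x ∷ xs) ys = trans (cong (ℤ._+_ (f x)) (∑-++ f xs ys)) (sym (ℤ.+-assoc (f x) _ _))

  ∑-concatMap : ∀ {B : Set} (f : A → ℤ) (g : B → List A) xs →
    ∑ f (concatMap g xs) ≡ ∑ (λ x → ∑ f (g x)) xs
  ∑-concatMap f g []       = refl
  ∑-concatMap f g (x ∷ xs) =
    trans (∑-++ f (g x) (concatMap g xs)) (cong (ℤ._+_ (∑ f (g x))) (∑-concatMap f g xs))

  ∑-map : ∀ {B : Set} (f : A → ℤ) (g : B → A) xs → ∑ f (map g xs) ≡ ∑ (f ∘ g) xs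
  ∑-map f g xs = cong sumℤ (sym (List.map-∘ xs))

  ∑-cong-local : ∀ {f g : A → ℤ} {xs} → All (λ x → f x ≡ g x) xs → ∑ f xs ≡ ∑ g xs
  ∑-cong-local []       = refl
  ∑-cong-local (e ∷ es) = cong₂ ℤ._+_ e (∑-cong-local es)

  ∑-neg : ∀ (f : A → ℤ) xs → ∑ (λ x → - f x) xs ≡ - ∑ f xs
  ∑-neg f []       = refl
  ∑-neg f (x ∷ xs) =
    trans (cong (ℤ._+_ (- f x)) (∑-neg f xs)) (sym (ℤ.neg-distrib-+ (f x) (∑ f xs)))

  ∑-filter : ∀ (p : A → Bool) (f : A → ℤ) xs →
    ∑ f (filter (λ x → T? (p x)) xs) ≡ ∑ (λ x → if p x then f x else + 0) xs
  ∑-filter p f []       = refl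
  ∑-filter p f (x ∷ xs) with p x
  ... | true  = cong (ℤ._+_ (f x)) (∑-filter p f xs)
  ... | false = trans (∑-filter p f xs) (sym (ℤ.+-identityˡ _))

negate^ : ℕ → ℤ → ℤ
negate^ zero    z = z
negate^ (suc e) z = - negate^ e z

negate^-+ : ∀ a b z → negate^ (a + b) z ≡ negate^ a (negate^ b z)
negate^-+ zero    b z = refl
negate^-+ (suc a) b z = cong -_ (negate^-+ a b z)

negate^-zero : ∀ e → negate^ e (+ 0) ≡ + 0
negate^-zero zero    = refl
negate^-zero (suc e) = cong -_ (negate^-zero e)

negate^-neg : ∀ e z → negate^ e (- z) ≡ - negate^ e z
negate^-neg zero    z = refl
negate^-neg (suc e) z = cong -_ (negate^-neg e z)

negate^-distrib-+ : ∀ e x y → negate^ e (x ℤ.+ y) ≡ negate^ e x ℤ.+ negate^ e y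
negate^-distrib-+ zero    x y = refl
negate^-distrib-+ (suc e) x y =
  trans (cong -_ (negate^-distrib-+ e x y)) (ℤ.neg-distrib-+ (negate^ e x) (negate^ e y))

negate^-distrib-− : ∀ e x y → negate^ e (x - y) ≡ negate^ e x - negate^ e y
negate^-distrib-− e x y =
  trans (negate^-distrib-+ e x (- y)) (cong (ℤ._+_ (negate^ e x)) (negate^-neg e y))

negate^-∑ : ∀ {A : Set} e (f : A → ℤ) xs → negate^ e (∑ f xs) ≡ ∑ (λ x → negate^ e (f x)) xs
negate^-∑ e f []       = negate^-zero e
negate^-∑ e f (x ∷ xs) =
  trans (negate^-distrib-+ e (f x) (∑ f xs)) (cong (ℤ._+_ (negate^ e (f x))) (negate^-∑ e f xs))

negate^-1-* : ∀ e z → negate^ e (+ 1) ℤ.* z ≡ negate^ e z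
negate^-1-* zero    z = ℤ.*-identityˡ z
negate^-1-* (suc e) z =
  trans (sym (ℤ.neg-distribˡ-* (negate^ e (+ 1)) z)) (cong -_ (negate^-1-* e z))

negate^-bit-xor : ∀ p q z → negate^ (bit (p xor q)) z ≡ negate^ (bit p + bit q) z
negate^-bit-xor true  true  z = sym (ℤ.neg-involutive z)
negate^-bit-xor true  false z = refl
negate^-bit-xor false q     z = refl

negate^-count-xor : ∀ {A : Set} (f g : A → Bool) xs z →
  negate^ (count (λ x → f x xor g x) xs) z ≡ negate^ (count f xs + count g xs) z
negate^-count-xor f g []       z = refl
negate^-count-xor f g (x ∷ xs) z = begin
  negate^ (bit (f x xor g x) + count (λ x → f x xor g x) xs) z
    ≡⟨ negate^-+ (bit (f x xor g x)) _ z ⟩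
  negate^ (bit (f x xor g x)) (negate^ (count (λ x → f x xor g x) xs) z)
    ≡⟨ negate^-bit-xor (f x) (g x) _ ⟩
  negate^ (p + q) (negate^ (count (λ x → f x xor g x) xs) z)
    ≡⟨ cong (negate^ (p + q)) (negate^-count-xor f g xs z) ⟩
  negate^ (p + q) (negate^ (count f xs + count g xs) z)
    ≡⟨ negate^-+ (p + q) (count f xs + count g xs) z ⟨
  negate^ ((p + q) + (count f xs + count g xs)) z
    ≡⟨ cong (λ e → negate^ e z) (+-interchange p q (count f xs) (count g xs)) ⟩
  negate^ ((p + count f xs) + (q + count g xs)) z ∎
  where
  open ≡-Reasoning
  p = bit (f x)
  q = bit (g x)

negate^-± : ∀ e z → negate^ e z ≡ z ⊎ negate^ e z ≡ - z
negate^-± zero    z = inj₁ refl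
negate^-± (suc e) z with negate^-± e z
... | inj₁ eq = inj₂ (cong -_ eq)
... | inj₂ eq = inj₁ (trans (cong -_ eq) (ℤ.neg-involutive z))

negOnePow-difference : ∀ a b → negOnePow (+ a - + b) ≡ negate^ (a + b) (+ 1)
negOnePow-difference a b rewrite ℤ.m-n≡m⊖n a b =
  trans (even?-sign ℤ.∣ a ℤ.⊖ b ∣) (∣⊖∣-parity a b)
  where
  even?-sign : ∀ m → (if even? m then + 1 else - + 1) ≡ negate^ m (+ 1)
  even?-sign zero          = refl
  even?-sign (suc zero)    = refl
  even?-sign (suc (suc m)) = trans (even?-sign m) (sym (ℤ.neg-involutive _))
  ∸-parity : ∀ a b → a ≤ b → negate^ (b ∸ a) (+ 1) ≡ negate^ (a + b) (+ 1)
  ∸-parity zero    b       _         = refl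
  ∸-parity (suc a) (suc b) (s≤s a≤b) = trans (∸-parity a b a≤b)
    (trans (sym (ℤ.neg-involutive _)) (cong (λ e → negate^ e (+ 1)) (sym (ℕ.+-suc (suc a) b))))
  ∣⊖∣-parity : ∀ a b → negate^ ℤ.∣ a ℤ.⊖ b ∣ (+ 1) ≡ negate^ (a + b) (+ 1)
  ∣⊖∣-parity a b with ℕ.≤-total a b
  ... | inj₁ a≤b rewrite ℤ.∣⊖∣-≤ a≤b = ∸-parity a b a≤b
  ... | inj₂ b≤a rewrite ℤ.∣m⊖n∣≡∣n⊖m∣ a b | ℤ.∣⊖∣-≤ b≤a =
    trans (∸-parity b a b≤a) (cong (λ e → negate^ e (+ 1)) (ℕ.+-comm b a))

insertions-↭ : ∀ x ys → All (_↭ x ∷ ys) (insertions x ys)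
insertions-↭ x []       = ↭-refl ∷ []
insertions-↭ x (y ∷ ys) = ↭-refl ∷ All.map⁺
  (All.map (λ p → ↭-trans (↭-prep y p) (↭-swap y x ↭-refl)) (insertions-↭ x ys))

perms-↭ : ∀ xs → All (_↭ xs) (perms xs)
perms-↭ []       = ↭-refl ∷ []
perms-↭ (x ∷ xs) = All.concat⁺ (All.map⁺ (All.map
  (λ {ys} ys↭xs → All.map (λ zs↭ → ↭-trans zs↭ (↭-prep x ys↭xs)) (insertions-↭ x ys))
  (perms-↭ xs)))

All-perms : ∀ {P : ℕ → Set} {xs} → All P xs → All (All P) (perms xs)
All-perms {xs = xs} pxs = All.map (λ ys↭xs → All-resp-↭ (↭-sym ys↭xs) pxs) (perms-↭ xs)

length-perms : ∀ xs → All (λ ys → length ys ≡ length xs) (perms xs)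
length-perms xs = All.map ↭-length (perms-↭ xs)

-- Polynomials in t as coefficient sequences

Poly : Set
Poly = ℕ → ℤ

0ₚ : Poly
0ₚ _ = + 0

_+ₚ_ : Poly → Poly → Poly
(P +ₚ Q) k = P k ℤ.+ Q k

_-ₚ_ : Poly → Poly → Poly
(P -ₚ Q) k = P k - Q k

monomial : ℕ → Poly
monomial m k = if m ≡ᵇ k then + 1 else + 0

shiftIf : Bool → Poly → Poly
shiftIf false P k       = P k
shiftIf true  P zero    = + 0
shiftIf true  P (suc k) = P k

shiftIf-cong : ∀ b {P Q} → P ≗ Q → shiftIf b P ≗ shiftIf b Q
shiftIf-cong false P≗Q k       = P≗Q k
shiftIf-cong true  P≗Q zero    = refl
shiftIf-cong true  P≗Q (suc k) = P≗Q k

shiftIf-comm : ∀ b c P → shiftIf b (shiftIf c P) ≗ shiftIf c (shiftIf b P)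
shiftIf-comm false c     P k       = refl
shiftIf-comm true  false P k       = refl
shiftIf-comm true  true  P zero    = refl
shiftIf-comm true  true  P (suc k) = refl

shiftIf-natural : ∀ b (g : ℤ → ℤ) → g (+ 0) ≡ + 0 →
  ∀ P → shiftIf b (g ∘ P) ≗ g ∘ shiftIf b P
shiftIf-natural false g g0 P k       = refl
shiftIf-natural true  g g0 P zero    = sym g0
shiftIf-natural true  g g0 P (suc k) = refl

shiftIf-0 : ∀ b → shiftIf b 0ₚ ≗ 0ₚ
shiftIf-0 b = shiftIf-natural b (λ _ → + 0) refl 0ₚ

shiftIf-+ : ∀ b P Q → shiftIf b (P +ₚ Q) ≗ shiftIf b P +ₚ shiftIf b Q
shiftIf-+ false P Q k       = refl
shiftIf-+ true  P Q zero    = refl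
shiftIf-+ true  P Q (suc k) = refl

shiftIf-− : ∀ b P Q → shiftIf b (P -ₚ Q) ≗ shiftIf b P -ₚ shiftIf b Q
shiftIf-− false P Q k       = refl
shiftIf-− true  P Q zero    = refl
shiftIf-− true  P Q (suc k) = refl

shiftIf-∑ : ∀ {A : Set} b (F : A → Poly) xs →
  shiftIf b (λ k → ∑ (λ x → F x k) xs) ≗ λ k → ∑ (λ x → shiftIf b (F x) k) xs
shiftIf-∑ b F []       k = shiftIf-0 b k
shiftIf-∑ b F (x ∷ xs) k = trans (shiftIf-+ b (F x) (λ k → ∑ (λ x → F x k) xs) k)
  (cong (ℤ._+_ (shiftIf b (F x) k)) (shiftIf-∑ b F xs k))

monomial-bit : ∀ b m → monomial (bit b + m) ≗ shiftIf b (monomial m)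
monomial-bit false m k       = refl
monomial-bit true  m zero    = refl
monomial-bit true  m (suc k) = refl

t[t-1]^ : ℕ → Poly
t[t-1]^ zero    = monomial 1
t[t-1]^ (suc L) = shiftIf true (t[t-1]^ L) -ₚ t[t-1]^ L

t[t-1]^-coeff-0 : ∀ L → t[t-1]^ L 0 ≡ + 0
t[t-1]^-coeff-0 zero    = refl
t[t-1]^-coeff-0 (suc L) = trans (ℤ.+-identityˡ _) (cong -_ (t[t-1]^-coeff-0 L))

t[t-1]^-coeff : ∀ L k → t[t-1]^ L (suc k) ≡ negate^ (L + k) (+ (L C k))
t[t-1]^-coeff zero    zero    = refl
t[t-1]^-coeff zero    (suc k) rewrite k>n⇒nCk≡0 {0} {suc k} (s≤s z≤n) = sym (negate^-zero (suc k))
t[t-1]^-coeff (suc L) zero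
  rewrite t[t-1]^-coeff-0 L | t[t-1]^-coeff L 0 | ℕ.+-identityʳ L = ℤ.+-identityˡ _
t[t-1]^-coeff (suc L) (suc k) rewrite t[t-1]^-coeff L k | t[t-1]^-coeff L (suc k) | ℕ.+-suc L k = begin
  negate^ (L + k) (+ (L C k)) - negate^ (suc (L + k)) (+ (L C suc k))
    ≡⟨ cong (ℤ._+_ (negate^ (L + k) (+ (L C k)))) (ℤ.neg-involutive _) ⟩
  negate^ (L + k) (+ (L C k)) ℤ.+ negate^ (L + k) (+ (L C suc k))
    ≡⟨ negate^-distrib-+ (L + k) _ _ ⟨
  negate^ (L + k) (+ (L C k + L C suc k))
    ≡⟨ cong (negate^ (L + k) ∘ +_) (nCk+nC[k+1]≡[n+1]C[k+1] L k) ⟩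
  negate^ (L + k) (+ (suc L C suc k))
    ≡⟨ ℤ.neg-involutive _ ⟨
  - - negate^ (L + k) (+ (suc L C suc k)) ∎
  where open ≡-Reasoning

-- The signed weak-excedence polynomial

inversions : List ℕ → ℕ
inversions []       = 0
inversions (z ∷ zs) = count (_<ᵇ z) zs + inversions zs

weakExcedences : List ℕ → List ℕ → ℕ
weakExcedences (c ∷ cs) (z ∷ zs) = bit (c ≤ᵇ z) + weakExcedences cs zs
weakExcedences _        _        = 0

weight : List ℕ → List ℕ → Poly
weight cs zs = negate^ (inversions zs) ∘ monomial (weakExcedences cs zs)

-- For increasing V, signedWex V cs is the determinant of (t^[c ≤ v]) with rows c ∈ cs and
-- columns v ∈ V.
signedWex : List ℕ → List ℕ → Poly
signedWex V cs k = ∑ (λ zs → weight cs zs k) (perms V)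

-- Laplace expansion along the column of the least value x: deleting the p-th row c contributes
-- (-1)^p t^[c ≤ x] times the remaining minor.
expand : ℕ → List ℕ → (List ℕ → Poly) → Poly
expand x []       F = 0ₚ
expand x (c ∷ cs) F = shiftIf (c ≤ᵇ x) (F cs) -ₚ expand x cs (F ∘ (c ∷_))

module _ (x : ℕ) where

  expand-cong : ∀ cs {F G} → (∀ d → F d ≗ G d) → expand x cs F ≗ expand x cs G
  expand-cong []       F≗G k = refl
  expand-cong (c ∷ cs) F≗G k =
    cong₂ _-_ (shiftIf-cong (c ≤ᵇ x) (F≗G cs) k) (expand-cong cs (F≗G ∘ (c ∷_)) k)

  expand-0 : ∀ cs → expand x cs (λ _ → 0ₚ) ≗ 0ₚ
  expand-0 []       k = refl
  expand-0 (c ∷ cs) k = cong₂ _-_ (shiftIf-0 (c ≤ᵇ x) k) (expand-0 cs k)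

  expand-+ : ∀ cs F G → expand x cs (λ d → F d +ₚ G d) ≗ expand x cs F +ₚ expand x cs G
  expand-+ []       F G k = refl
  expand-+ (c ∷ cs) F G k = begin
    shiftIf b (F cs +ₚ G cs) k - expand x cs (λ d → F (c ∷ d) +ₚ G (c ∷ d)) k
      ≡⟨ cong₂ _-_ (shiftIf-+ b (F cs) (G cs) k) (expand-+ cs (F ∘ (c ∷_)) (G ∘ (c ∷_)) k) ⟩
    (sF ℤ.+ sG) - (eF ℤ.+ eG)
      ≡⟨ cong (ℤ._+_ (sF ℤ.+ sG)) (ℤ.neg-distrib-+ eF eG) ⟩
    (sF ℤ.+ sG) ℤ.+ (- eF ℤ.+ - eG)
      ≡⟨ ℤ-+-interchange sF sG (- eF) (- eG) ⟩
    (sF - eF) ℤ.+ (sG - eG) ∎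
    where
    open ≡-Reasoning
    b  = c ≤ᵇ x
    sF = shiftIf b (F cs) k
    sG = shiftIf b (G cs) k
    eF = expand x cs (F ∘ (c ∷_)) k
    eG = expand x cs (G ∘ (c ∷_)) k

  expand-∑ : ∀ {A : Set} cs (F : A → List ℕ → Poly) ys →
    expand x cs (λ d k → ∑ (λ y → F y d k) ys) ≗ λ k → ∑ (λ y → expand x cs (F y) k) ys
  expand-∑ cs F []       = expand-0 cs
  expand-∑ cs F (y ∷ ys) k = trans (expand-+ cs (F y) (λ d k → ∑ (λ y → F y d k) ys) k)
    (cong (ℤ._+_ (expand x cs (F y) k)) (expand-∑ cs F ys k))

  expand-negate^-shiftIf : ∀ cs e b F →
    expand x cs (λ d → negate^ e ∘ shiftIf b (F d)) ≗ negate^ e ∘ shiftIf b (expand x cs F)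
  expand-negate^-shiftIf []       e b F k =
    sym (trans (cong (negate^ e) (shiftIf-0 b k)) (negate^-zero e))
  expand-negate^-shiftIf (c ∷ cs) e b F k = begin
    shiftIf b′ (negate^ e ∘ shiftIf b (F cs)) k - expand x cs (λ d → negate^ e ∘ shiftIf b (G d)) k
      ≡⟨ cong₂ _-_ (shiftIf-natural b′ (negate^ e) (negate^-zero e) (shiftIf b (F cs)) k)
                   (expand-negate^-shiftIf cs e b G k) ⟩
    negate^ e (shiftIf b′ (shiftIf b (F cs)) k) - negate^ e (shiftIf b (expand x cs G) k)
      ≡⟨ cong (λ u → negate^ e u - negate^ e (shiftIf b (expand x cs G) k))
              (shiftIf-comm b′ b (F cs) k) ⟩
    negate^ e (shiftIf b (shiftIf b′ (F cs)) k) - negate^ e (shiftIf b (expand x cs G) k)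
      ≡⟨ negate^-distrib-− e _ _ ⟨
    negate^ e (shiftIf b (shiftIf b′ (F cs)) k - shiftIf b (expand x cs G) k)
      ≡⟨ cong (negate^ e) (shiftIf-− b (shiftIf b′ (F cs)) (expand x cs G) k) ⟨
    negate^ e (shiftIf b (expand x (c ∷ cs) F) k) ∎
    where
    open ≡-Reasoning
    b′ = c ≤ᵇ x
    G  = F ∘ (c ∷_)

  expand-vanishing : ∀ cs F → (∀ d → suc (length d) ≡ length cs → F d ≗ 0ₚ) →
    expand x cs F ≗ 0ₚ
  expand-vanishing []       F F≗0 k = refl
  expand-vanishing (c ∷ cs) F F≗0 k =
    cong₂ _-_ (trans (shiftIf-cong (c ≤ᵇ x) (F≗0 cs refl) k) (shiftIf-0 (c ≤ᵇ x) k))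
              (expand-vanishing cs (F ∘ (c ∷_)) (λ d eq → F≗0 (c ∷ d) (cong suc eq)) k)

weight-∷ : ∀ c cs z zs →
  weight (c ∷ cs) (z ∷ zs) ≗ negate^ (count (_<ᵇ z) zs) ∘ shiftIf (c ≤ᵇ z) (weight cs zs)
weight-∷ c cs z zs k = begin
  negate^ (n + i) (monomial (bit b + w) k)
    ≡⟨ negate^-+ n i _ ⟩
  negate^ n (negate^ i (monomial (bit b + w) k))
    ≡⟨ cong (negate^ n ∘ negate^ i) (monomial-bit b w k) ⟩
  negate^ n (negate^ i (shiftIf b (monomial w) k))
    ≡⟨ cong (negate^ n) (shiftIf-natural b (negate^ i) (negate^-zero i) (monomial w) k) ⟨
  negate^ n (shiftIf b (weight cs zs) k) ∎
  where
  open ≡-Reasoning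
  n = count (_<ᵇ z) zs
  i = inversions zs
  b = c ≤ᵇ z
  w = weakExcedences cs zs

count-<ᵇ-below : ∀ {x ys} → All (x <_) ys → count (_<ᵇ x) ys ≡ 0
count-<ᵇ-below []           = refl
count-<ᵇ-below (x<y ∷ x<ys) rewrite <ᵇ-false (ℕ.<⇒≤ x<y) = count-<ᵇ-below x<ys

∑-insertions : ∀ x ys cs → All (x <_) ys → length cs ≡ suc (length ys) →
  (λ k → ∑ (λ zs → weight cs zs k) (insertions x ys)) ≗ expand x cs (λ d → weight d ys)
∑-insertions x []       (c ∷ []) []           refl k = cong (ℤ._+ + 0) (monomial-bit (c ≤ᵇ x) 0 k)
∑-insertions x (y ∷ ys) (c ∷ cs) (x<y ∷ x<ys) len  k = cong₂ ℤ._+_ x-first x-later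
  where
  open ≡-Reasoning
  e = count (_<ᵇ y) ys
  b = c ≤ᵇ y
  x-first : weight (c ∷ cs) (x ∷ y ∷ ys) k ≡ shiftIf (c ≤ᵇ x) (weight cs (y ∷ ys)) k
  x-first rewrite weight-∷ c cs x (y ∷ ys) k | count-<ᵇ-below (x<y ∷ x<ys) = refl
  y-first : ∀ {zs} → zs ↭ x ∷ ys →
    weight (c ∷ cs) (y ∷ zs) k ≡ - negate^ e (shiftIf b (weight cs zs) k)
  y-first {zs} zs↭ rewrite weight-∷ c cs y zs k | count-resp-↭ (_<ᵇ y) zs↭ | <ᵇ-true x<y = refl
  x-later : ∑ (λ zs → weight (c ∷ cs) zs k) (map (y ∷_) (insertions x ys))
          ≡ - expand x cs (λ d → weight (c ∷ d) (y ∷ ys)) k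
  x-later = begin
    ∑ (λ zs → weight (c ∷ cs) zs k) (map (y ∷_) (insertions x ys))
      ≡⟨ ∑-map _ (y ∷_) (insertions x ys) ⟩
    ∑ (λ zs → weight (c ∷ cs) (y ∷ zs) k) (insertions x ys)
      ≡⟨ ∑-cong-local (All.map y-first (insertions-↭ x ys)) ⟩
    ∑ (λ zs → - negate^ e (shiftIf b (weight cs zs) k)) (insertions x ys)
      ≡⟨ ∑-neg _ (insertions x ys) ⟩
    - ∑ (λ zs → negate^ e (shiftIf b (weight cs zs) k)) (insertions x ys)
      ≡⟨ cong -_ (negate^-∑ e _ (insertions x ys)) ⟨
    - negate^ e (∑ (λ zs → shiftIf b (weight cs zs) k) (insertions x ys))
      ≡⟨ cong (-_ ∘ negate^ e) (shiftIf-∑ b (weight cs) (insertions x ys) k) ⟨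
    - negate^ e (shiftIf b (λ k → ∑ (λ zs → weight cs zs k) (insertions x ys)) k)
      ≡⟨ cong (-_ ∘ negate^ e)
              (shiftIf-cong b (∑-insertions x ys cs x<ys (ℕ.suc-injective len)) k) ⟩
    - negate^ e (shiftIf b (expand x cs (λ d → weight d ys)) k)
      ≡⟨ cong -_ (expand-negate^-shiftIf x cs e b (λ d → weight d ys) k) ⟨
    - expand x cs (λ d → negate^ e ∘ shiftIf b (weight d ys)) k
      ≡⟨ cong -_ (expand-cong x cs (λ d → weight-∷ c d y ys) k) ⟨
    - expand x cs (λ d → weight (c ∷ d) (y ∷ ys)) k ∎

signedWex-∷ : ∀ x xs cs → All (x <_) xs → length cs ≡ suc (length xs) →
  signedWex (x ∷ xs) cs ≗ expand x cs (signedWex xs)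
signedWex-∷ x xs cs x<xs len k = begin
  ∑ (λ zs → weight cs zs k) (concatMap (insertions x) (perms xs))
    ≡⟨ ∑-concatMap _ (insertions x) (perms xs) ⟩
  ∑ (λ ys → ∑ (λ zs → weight cs zs k) (insertions x ys)) (perms xs)
    ≡⟨ ∑-cong-local (All.zipWith
         (λ (x<ys , len-ys) → ∑-insertions x _ cs x<ys (trans len (cong suc (sym len-ys))) k)
         (All-perms x<xs , length-perms xs)) ⟩
  ∑ (λ ys → expand x cs (λ d → weight d ys) k) (perms xs)
    ≡⟨ expand-∑ x cs (λ ys d → weight d ys) (perms xs) k ⟨
  expand x cs (signedWex xs) k ∎
  where open ≡-Reasoning

signedWex-row-irrelevant : ∀ V {c c′} d → All (c ≤_) V → All (c′ ≤_) V →
  signedWex V (c ∷ d) ≗ signedWex V (c′ ∷ d)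
signedWex-row-irrelevant V {c} {c′} d c≤V c′≤V k =
  ∑-cong-local (All.map same-weight (All-perms (All.zip (c≤V , c′≤V))))
  where
  same-weight : ∀ {zs} → All (λ v → c ≤ v × c′ ≤ v) zs →
    weight (c ∷ d) zs k ≡ weight (c′ ∷ d) zs k
  same-weight {[]}     _                  = refl
  same-weight {z ∷ zs} ((c≤z , c′≤z) ∷ _) rewrite ≤ᵇ-true c≤z | ≤ᵇ-true c′≤z = refl

interval : ℕ → ℕ → List ℕ
interval m zero    = []
interval m (suc L) = m ∷ interval (suc m) L

length-interval : ∀ m L → length (interval m L) ≡ L
length-interval m zero    = refl
length-interval m (suc L) = cong suc (length-interval (suc m) L)

interval-above : ∀ {c m} L → c ≤ m → All (c ≤_) (interval m L)
interval-above zero    c≤m = []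
interval-above (suc L) c≤m = c≤m ∷ interval-above L (ℕ.m≤n⇒m≤1+n c≤m)

-- All entries of the rows c₀ and c₁ are t, so the determinant vanishes.
signedWex-two-low-rows : ∀ m L {c₀ c₁} d → c₀ ≤ m → c₁ ≤ m → length d ≡ L →
  signedWex (interval m (suc (suc L))) (c₀ ∷ c₁ ∷ d) ≗ 0ₚ

expand-two-low-rows : ∀ x m L {c₀ c₁} d → c₀ ≤ m → c₁ ≤ m → length d ≡ L →
  expand x d (λ e → signedWex (interval m (suc L)) (c₀ ∷ c₁ ∷ e)) ≗ 0ₚ
expand-two-low-rows x m zero    []   _    _    refl k = refl
expand-two-low-rows x m (suc L) d c₀≤m c₁≤m len = expand-vanishing x d _
  (λ e len-e → signedWex-two-low-rows m L e c₀≤m c₁≤m (ℕ.suc-injective (trans len-e len)))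

signedWex-two-low-rows m L {c₀} {c₁} d c₀≤m c₁≤m len k = begin
  signedWex (m ∷ V) (c₀ ∷ c₁ ∷ d) k
    ≡⟨ signedWex-∷ m V (c₀ ∷ c₁ ∷ d) (interval-above (suc L) ℕ.≤-refl)
         (cong (suc ∘ suc) (trans len (sym (length-interval (suc (suc m)) L)))) k ⟩
  shiftIf (c₀ ≤ᵇ m) (Ψ c₁) k - (shiftIf (c₁ ≤ᵇ m) (Ψ c₀) k - expand m d F k)
    ≡⟨ cong₂ (λ b₀ b₁ → shiftIf b₀ (Ψ c₁) k - (shiftIf b₁ (Ψ c₀) k - expand m d F k))
             (≤ᵇ-true c₀≤m) (≤ᵇ-true c₁≤m) ⟩
  shiftIf true (Ψ c₁) k - (shiftIf true (Ψ c₀) k - expand m d F k)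
    ≡⟨ cong₂ (λ u v → u - (shiftIf true (Ψ c₀) k - v))
             (shiftIf-cong true (signedWex-row-irrelevant V d (V-above c₁≤m) (V-above c₀≤m)) k)
             (expand-two-low-rows m (suc m) L d
                (ℕ.m≤n⇒m≤1+n c₀≤m) (ℕ.m≤n⇒m≤1+n c₁≤m) len k) ⟩
  shiftIf true (Ψ c₀) k - (shiftIf true (Ψ c₀) k - + 0)
    ≡⟨ cong (_-_ (shiftIf true (Ψ c₀) k)) (ℤ.+-identityʳ _) ⟩
  shiftIf true (Ψ c₀) k - shiftIf true (Ψ c₀) k
    ≡⟨ ℤ.+-inverseʳ (shiftIf true (Ψ c₀) k) ⟩
  + 0 ∎
  where
  open ≡-Reasoning
  V = interval (suc m) (suc L)
  Ψ = λ c → signedWex V (c ∷ d)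
  F = λ e → signedWex V (c₀ ∷ c₁ ∷ e)
  V-above : ∀ {c} → c ≤ m → All (c ≤_) V
  V-above c≤m = interval-above (suc L) (ℕ.m≤n⇒m≤1+n c≤m)

signedWex-staircase : ∀ m L {c} → c ≤ m →
  signedWex (interval m (suc L)) (c ∷ interval (suc m) L) ≗ t[t-1]^ L
signedWex-staircase m zero    c≤m k rewrite ≤ᵇ-true c≤m = ℤ.+-identityʳ (monomial 1 k)
signedWex-staircase m (suc L) {c} c≤m k = begin
  signedWex (m ∷ V) (c ∷ suc m ∷ d) k
    ≡⟨ signedWex-∷ m V (c ∷ suc m ∷ d) (interval-above (suc L) ℕ.≤-refl) refl k ⟩
  shiftIf (c ≤ᵇ m) (Ψ (suc m)) k - (shiftIf (suc m ≤ᵇ m) (Ψ c) k - expand m d F k)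
    ≡⟨ cong₂ (λ b₀ b₁ → shiftIf b₀ (Ψ (suc m)) k - (shiftIf b₁ (Ψ c) k - expand m d F k))
             (≤ᵇ-true c≤m) (≤ᵇ-false (ℕ.n<1+n m)) ⟩
  shiftIf true (Ψ (suc m)) k - (Ψ c k - expand m d F k)
    ≡⟨ cong₂ _-_ (shiftIf-cong true (signedWex-staircase (suc m) L ℕ.≤-refl) k)
                 (cong₂ _-_ (signedWex-staircase (suc m) L (ℕ.m≤n⇒m≤1+n c≤m) k)
                            (expand-two-low-rows m (suc m) L d (ℕ.m≤n⇒m≤1+n c≤m) ℕ.≤-refl
                               (length-interval (suc (suc m)) L) k)) ⟩
  shiftIf true (t[t-1]^ L) k - (t[t-1]^ L k - + 0)
    ≡⟨ cong (_-_ (shiftIf true (t[t-1]^ L) k)) (ℤ.+-identityʳ (t[t-1]^ L k)) ⟩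
  t[t-1]^ (suc L) k ∎
  where
  open ≡-Reasoning
  V = interval (suc m) (suc L)
  d = interval (suc (suc m)) L
  Ψ = λ c → signedWex V (c ∷ d)
  F = λ e → signedWex V (c ∷ suc m ∷ e)

applyUpTo-interval : ∀ (f : ℕ → ℕ) m n → (∀ i → f i ≡ m + i) → applyUpTo f n ≡ interval m n
applyUpTo-interval f m zero    f≗m+ = refl
applyUpTo-interval f m (suc n) f≗m+ = cong₂ _∷_ (trans (f≗m+ 0) (ℕ.+-identityʳ m))
  (applyUpTo-interval (f ∘ suc) (suc m) n (λ i → trans (f≗m+ (suc i)) (ℕ.+-suc m i)))

range≡interval : ∀ n → range n ≡ interval 1 n
range≡interval n =
  trans (List.map-applyUpTo (λ i → i) suc n) (applyUpTo-interval suc 1 n (λ i → refl))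

signedWex-range : ∀ L → signedWex (range (suc L)) (range (suc L)) ≗ t[t-1]^ L
signedWex-range L k = subst (λ R → signedWex R R k ≡ t[t-1]^ L k) (sym (range≡interval (suc L)))
  (signedWex-staircase 1 L ℕ.≤-refl k)

-- From alignments to inversions and weak excedences

length-range : ∀ n → length (range n) ≡ n
length-range n = trans (cong length (range≡interval n)) (length-interval 1 n)

range-sorted : ∀ n → AllPairs _<_ (range n)
range-sorted n = subst (AllPairs _<_) (sym (range≡interval n)) (interval-sorted 1 n)
  where
  interval-sorted : ∀ m L → AllPairs _<_ (interval m L)
  interval-sorted m zero    = []
  interval-sorted m (suc L) = interval-above L ℕ.≤-refl ∷ interval-sorted (suc m) L

map-app-range : ∀ π {n} → length π ≡ n → map (app π) (range n) ≡ π
map-app-range π refl = begin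
  map (app π) (map suc (upTo (length π))) ≡⟨ List.map-∘ (upTo (length π)) ⟨
  map (nth π) (upTo (length π))           ≡⟨ List.map-applyUpTo (λ i → i) (nth π) (length π) ⟩
  applyUpTo (nth π) (length π)            ≡⟨ applyUpTo-nth π ⟩
  π                                       ∎
  where
  open ≡-Reasoning
  applyUpTo-nth : ∀ ys → applyUpTo (nth ys) (length ys) ≡ ys
  applyUpTo-nth []       = refl
  applyUpTo-nth (y ∷ ys) = cong (y ∷_) (applyUpTo-nth ys)

pairs≡orderedPairs : ∀ n → pairs n ≡ orderedPairs (range n)
pairs≡orderedPairs n = sorted⇒pairsAbove (range-sorted n)
  where
  above : ℕ → List ℕ → List ℕ
  above i = filter (λ j → T? (i <ᵇ j))
  pairsAbove : List ℕ → List ℕ → List (ℕ × ℕ)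
  pairsAbove R S = concatMap (λ i → map (i ,_) (above i S)) R
  skip-below : ∀ {x R} S → All (x <_) R → pairsAbove R (x ∷ S) ≡ pairsAbove R S
  skip-below             S []          = refl
  skip-below {x} {i ∷ R} S (x<i ∷ x<R) = cong₂ _++_
    (cong (map (i ,_)) (List.filter-reject (λ j → T? (i <ᵇ j)) {x} {S}
                          (λ i<x → ℕ.<-asym x<i (ℕ.<ᵇ⇒< i x i<x))))
    (skip-below S x<R)
  sorted⇒pairsAbove : ∀ {R} → AllPairs _<_ R → pairsAbove R R ≡ orderedPairs R
  sorted⇒pairsAbove {[]}    []               = refl
  sorted⇒pairsAbove {x ∷ R} (x<R ∷ R-sorted) = cong₂ _++_
    (cong (map (x ,_)) (trans (List.filter-reject (λ j → T? (x <ᵇ j)) {x} {R}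
                                 (λ x<x → ℕ.<-irrefl refl (ℕ.<ᵇ⇒< x x x<x)))
                              (List.filter-all (λ j → T? (x <ᵇ j)) (All.map ℕ.<⇒<ᵇ x<R))))
    (trans (skip-below R x<R) (sorted⇒pairsAbove R-sorted))

count-orderedPairs-inversions : ∀ (f : ℕ → ℕ) R →
  count (λ (i , j) → f j <ᵇ f i) (orderedPairs R) ≡ inversions (map f R)
count-orderedPairs-inversions f []      = refl
count-orderedPairs-inversions f (x ∷ R) = trans
  (count-++ (λ (i , j) → f j <ᵇ f i) (map (x ,_) R) (orderedPairs R))
  (cong₂ _+_ (trans (count-map _ (x ,_) R) (sym (count-map (_<ᵇ f x) f R)))
             (count-orderedPairs-inversions f R))

count-weakExcedences : ∀ (f : ℕ → ℕ) R →
  count (λ i → i ≤ᵇ f i) R ≡ weakExcedences R (map f R)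
count-weakExcedences f []      = refl
count-weakExcedences f (x ∷ R) = cong (_+_ (bit (x ≤ᵇ f x))) (count-weakExcedences f R)

weakExc≡weakExcedences : ∀ n π → length π ≡ n → weakExc n π ≡ weakExcedences (range n) π
weakExc≡weakExcedences n π len = begin
  weakExc n π
    ≡⟨ length-filter≡count (λ i → i ≤ᵇ app π i) (range n) ⟩
  count (λ i → i ≤ᵇ app π i) (range n)
    ≡⟨ count-weakExcedences (app π) (range n) ⟩
  weakExcedences (range n) (map (app π) (range n))
    ≡⟨ cong (weakExcedences (range n)) (map-app-range π len) ⟩
  weakExcedences (range n) π ∎
  where open ≡-Reasoning

al-parity : ∀ n π → π ↭ range n → ∀ z →
  negate^ (al n π) z ≡ negate^ (inversions π + (n ∸ 1) * weakExc n π) z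
al-parity n π π↭ z = begin
  negate^ (al n π) z
    ≡⟨ cong (λ e → negate^ e z)
         (trans (length-filter≡count isAl (pairs n)) (cong (count isAl) (pairs≡orderedPairs n))) ⟩
  negate^ (count isAl ps) z
    ≡⟨ cong (λ e → negate^ e z) (count-cong-local (All.map (λ {(i , j)} (i<j , πi≢πj) →
         trans (isAlignment≡alignBit π i j) (alignBit-parity i<j πi≢πj)) pair-facts)) ⟩
  negate^ (count (λ p → (inv p xor wex₁ p) xor wex₂ p) ps) z
    ≡⟨ negate^-count-xor (λ p → inv p xor wex₁ p) wex₂ ps z ⟩
  negate^ (count (λ p → inv p xor wex₁ p) ps + count wex₂ ps) z
    ≡⟨ negate^-+ (count (λ p → inv p xor wex₁ p) ps) (count wex₂ ps) z ⟩
  negate^ (count (λ p → inv p xor wex₁ p) ps) (negate^ (count wex₂ ps) z)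
    ≡⟨ negate^-count-xor inv wex₁ ps _ ⟩
  negate^ (count inv ps + count wex₁ ps) (negate^ (count wex₂ ps) z)
    ≡⟨ negate^-+ (count inv ps + count wex₁ ps) (count wex₂ ps) z ⟨
  negate^ ((count inv ps + count wex₁ ps) + count wex₂ ps) z
    ≡⟨ cong (λ e → negate^ e z) (ℕ.+-assoc (count inv ps) (count wex₁ ps) (count wex₂ ps)) ⟩
  negate^ (count inv ps + (count wex₁ ps + count wex₂ ps)) z
    ≡⟨ cong₂ (λ u v → negate^ (u + v) z) inversions≡ weakExcedences≡ ⟩
  negate^ (inversions π + (n ∸ 1) * weakExc n π) z ∎
  where
  open ≡-Reasoning
  R  = range n
  ps = orderedPairs R
  isAl inv wex₁ wex₂ : ℕ × ℕ → Bool
  isAl (i , j) = isAlignment π i j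
  inv  (i , j) = app π j <ᵇ app π i
  wex₁ (i , j) = i ≤ᵇ app π i
  wex₂ (i , j) = j ≤ᵇ app π j
  π-on-R : map (app π) R ≡ π
  π-on-R = map-app-range π (trans (↭-length π↭) (length-range n))
  π-distinct : AllPairs _≢_ (map (app π) R)
  π-distinct = subst (AllPairs _≢_) (sym π-on-R)
    (Unique-resp-↭ (↭⇒↭ₛ (↭-sym π↭)) (AllPairs.map ℕ.<⇒≢ (range-sorted n)))
  pair-facts : All (λ (i , j) → i < j × app π i ≢ app π j) ps
  pair-facts = All.zip ( AllPairs⇒All-orderedPairs (range-sorted n)
                       , AllPairs⇒All-orderedPairs (AllPairs.map⁻ π-distinct))
  inversions≡ : count inv ps ≡ inversions π
  inversions≡ = trans (count-orderedPairs-inversions (app π) R) (cong inversions π-on-R)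
  weakExcedences≡ : count wex₁ ps + count wex₂ ps ≡ (n ∸ 1) * weakExc n π
  weakExcedences≡ = trans (count-orderedPairs-endpoints (λ i → i ≤ᵇ app π i) R)
    (cong₂ (λ l c → (l ∸ 1) * c) (length-range n)
           (sym (length-filter≡count (λ i → i ≤ᵇ app π i) R)))

E-at-neg1≡signedWex : ∀ k n →
  E-at-neg1 k n ≡ negate^ (k * (n ∸ k) + (n ∸ 1) * k) (signedWex (range n) (range n) k)
E-at-neg1≡signedWex k n = begin
  ∑ (λ π → negOnePow (expE k n π)) (SymK k n)
    ≡⟨ ∑-filter (λ π → weakExc n π ≡ᵇ k) _ (Sym n) ⟩
  ∑ (λ π → if weakExc n π ≡ᵇ k then negOnePow (expE k n π) else + 0) (Sym n)
    ≡⟨ ∑-cong-local (All.map term (perms-↭ (range n))) ⟩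
  ∑ (λ π → negate^ c (weight (range n) π k)) (Sym n)
    ≡⟨ negate^-∑ c _ (Sym n) ⟨
  negate^ c (signedWex (range n) (range n) k) ∎
  where
  open ≡-Reasoning
  c = k * (n ∸ k) + (n ∸ 1) * k
  term : ∀ {π} → π ↭ range n →
    (if weakExc n π ≡ᵇ k then negOnePow (expE k n π) else + 0) ≡ negate^ c (weight (range n) π k)
  term {π} π↭ with weakExc n π ≡ᵇ k in wex≡k
                 | weakExc≡weakExcedences n π (trans (↭-length π↭) (length-range n))
  ... | false | wex≡ rewrite sym wex≡ | wex≡k =
    sym (trans (cong (negate^ c) (negate^-zero (inversions π))) (negate^-zero c))
  ... | true  | wex≡ rewrite sym wex≡ | wex≡k = begin
    negOnePow (+ (k * (n ∸ k)) - + al n π)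
      ≡⟨ negOnePow-difference (k * (n ∸ k)) (al n π) ⟩
    negate^ (k * (n ∸ k) + al n π) (+ 1)
      ≡⟨ negate^-+ (k * (n ∸ k)) (al n π) (+ 1) ⟩
    negate^ (k * (n ∸ k)) (negate^ (al n π) (+ 1))
      ≡⟨ cong (negate^ (k * (n ∸ k))) (al-parity n π π↭ (+ 1)) ⟩
    negate^ (k * (n ∸ k)) (negate^ (inversions π + (n ∸ 1) * weakExc n π) (+ 1))
      ≡⟨ cong (λ w → negate^ (k * (n ∸ k)) (negate^ (inversions π + (n ∸ 1) * w) (+ 1)))
              (ℕ.≡ᵇ⇒≡ _ k (subst T (sym wex≡k) _)) ⟩
    negate^ (k * (n ∸ k)) (negate^ (inversions π + (n ∸ 1) * k) (+ 1))
      ≡⟨ negate^-+ (k * (n ∸ k)) (inversions π + (n ∸ 1) * k) (+ 1) ⟨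
    negate^ (k * (n ∸ k) + (inversions π + (n ∸ 1) * k)) (+ 1)
      ≡⟨ cong (λ e → negate^ e (+ 1)) (+-assoc-comm (k * (n ∸ k)) (inversions π) ((n ∸ 1) * k)) ⟩
    negate^ (c + inversions π) (+ 1)
      ≡⟨ negate^-+ c (inversions π) (+ 1) ⟩
    negate^ c (negate^ (inversions π) (+ 1)) ∎
    where
    +-assoc-comm : ∀ a i b → a + (i + b) ≡ (a + b) + i
    +-assoc-comm a i b = trans (cong (_+_ a) (ℕ.+-comm i b)) (sym (ℕ.+-assoc a b i))

proposition5p7 : (k n : ℕ) → 1 ≤ k → k ≤ n →
    (Ehat-at-neg1 k n ≡ + ((n ∸ 1) C (k ∸ 1))) ⊎ (Ehat-at-neg1 k n ≡ - (+ ((n ∸ 1) C (k ∸ 1))))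
proposition5p7 (suc k) (suc L) _ _ = Sum.map (trans Ehat≡) (trans Ehat≡) (negate^-± e (+ (L C k)))
  where
  open ≡-Reasoning
  a = suc k + suc L
  b = suc k * (suc L ∸ suc k) + (suc L ∸ 1) * suc k
  e = a + (b + (L + k))
  Ehat≡ : Ehat-at-neg1 (suc k) (suc L) ≡ negate^ e (+ (L C k))
  Ehat≡ = begin
    negOnePow (+ suc k - + suc L) ℤ.* E-at-neg1 (suc k) (suc L)
      ≡⟨ cong₂ ℤ._*_ (negOnePow-difference (suc k) (suc L)) (E-at-neg1≡signedWex (suc k) (suc L)) ⟩
    negate^ a (+ 1) ℤ.* negate^ b (signedWex (range (suc L)) (range (suc L)) (suc k))
      ≡⟨ negate^-1-* a _ ⟩
    negate^ a (negate^ b (signedWex (range (suc L)) (range (suc L)) (suc k)))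
      ≡⟨ cong (negate^ a ∘ negate^ b) (trans (signedWex-range L (suc k)) (t[t-1]^-coeff L k)) ⟩
    negate^ a (negate^ b (negate^ (L + k) (+ (L C k))))
      ≡⟨ trans (negate^-+ a (b + (L + k)) _) (cong (negate^ a) (negate^-+ b (L + k) _)) ⟨
    negate^ e (+ (L C k)) ∎
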